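{- Let $r\in\mathbb N$. For every $n\in\mathbb N_0$, \[ p_e(n,2r)=p_o(n,2r)+q_o(n,r), \] where $p_e(n,2r)$ (resp. $p_o(n,2r)$) is the number of partitions of $n$ (all parts allowed) in which the number of parts divisible by $2r$ (counted with multiplicity) is even (resp. odd), and $q_o(n,r)$ is the number of partitions of $n$ in which no part is divisible by $2r$ and the parts divisible by $r$ are distinct (equivalently, all parts divisible by $r$ are distinct odd multiples of $r$).
   Context: A partition of $n$ is a non-increasing sequence of positive integers summing to $n$; the empty partition is the unique partition of $0$. -}

module Defs where

open import Data.Nat using (ℕ; zero; suc; _+_; _*_; _∸_; _≤_; _≤?_; _≟_; NonZero)
open import Data.Nat.Divisibility using (_∣_; _∣?_)
open import Data.List using (List; []; _∷_; length; filter; concatMap; upTo; map)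
open import Data.Nat.ListAction using (sum)
open import Data.List.Relation.Unary.Linked using (Linked)
open import Data.List.Relation.Unary.All using (All)
open import Data.List.Relation.Unary.All using (all?)
open import Data.List.Relation.Unary.Unique.Propositional using (Unique)
open import Data.List.Relation.Unary.Unique.DecPropositional Data.Nat._≟_ using (unique?)
open import Data.Product using (_×_)
open import Relation.Nullary.Decidable using (does; ¬?; _×-dec_)
open import Relation.Unary using (Pred; Decidable)
open import Relation.Binary.PropositionalEquality using (_≡_)
open import Data.Nat using (_≥_)

IsPartition : ℕ → List ℕ → Set
IsPartition n xs = All (λ x → 1 ≤ x) xs × Linked _≥_ xs × sum xs ≡ n

-- Enumeration of all partitions of n whose parts are all ≤ m, listed as
-- non-increasing lists.  The first argument is fuel (≥ n suffices).
partsBounded : ℕ → ℕ → ℕ → List (List ℕ)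
partsBounded _        zero    _ = [] ∷ []
partsBounded zero     (suc _) _ = []
partsBounded (suc f)  (suc n) m =
  concatMap (λ k → map (λ rest → suc k ∷ rest)
                       (partsBounded f (suc n ∸ suc k) (suc k)))
            (filter (λ k → suc k ≤? m) (upTo (suc n)))

partitions : ℕ → List (List ℕ)
partitions n = partsBounded n n n

countDiv : ℕ → List ℕ → ℕ
countDiv d xs = length (filter (λ x → d ∣? x) xs)

pe : ℕ → ℕ → ℕ
pe n d = length (filter (λ xs → 2 ∣? countDiv d xs) (partitions n))

po : ℕ → ℕ → ℕ
po n d = length (filter (λ xs → ¬? (2 ∣? countDiv d xs)) (partitions n))

DistinctMultiples : ℕ → List ℕ → Set
DistinctMultiples r xs = Unique (filter (λ x → r ∣? x) xs)

qo : ℕ → ℕ → ℕ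
qo n r = length (filter (λ xs → all? (λ x → ¬? (2 * r ∣? x)) xs
                                  ×-dec unique? (filter (λ x → r ∣? x) xs))
                        (partitions n))

module Submission where

-- A sign-reversing involution on partitions.  Call a partition exceptional when no part is
-- divisible by 2r and its parts divisible by r are distinct; these are the partitions counted
-- by qo, and having no part divisible by 2r they are also counted by pe.  Any other
-- partition of n has a least a ∈ [1, n] such that the part 2ra occurs an odd number of times
-- or the part ra occurs at least twice.  Toggling at a merges two parts ra into one part 2ra
-- if 2ra occurs an even number of times, and splits one part 2ra into two parts ra otherwise.
-- This keeps the sum, keeps a the least such index (only the multiplicities of ra and 2ra
-- change, and that of ra by two), undoes itself, and changes the number of parts divisible
-- by 2r by exactly one.  So it pairs the non-exceptional partitions of n with an even number
-- of parts divisible by 2r with those with an odd number, and pe = po + qo.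

open import Defs

open import Data.Bool using (if_then_else_)
open import Data.Empty using (⊥; ⊥-elim)
open import Data.List using (List; []; _∷_; length; filter; concatMap; upTo)
open import Data.List.Properties
  using (≡-dec; ∷-injectiveˡ; ∷-injectiveʳ; filter-accept; filter-reject; filter-none; filter-some; filter-notAll)
open import Data.List.Membership.Propositional using (_∈_; find; lose)
open import Data.List.Membership.Propositional.Properties
  using (∈-filter⁺; ∈-filter⁻; ∈-map⁺; ∈-map⁻; ∈-concatMap⁺; ∈-concatMap⁻; ∈-upTo⁺; ∈-upTo⁻)
open import Data.List.Relation.Binary.Permutation.Propositional
  using (_↭_; ↭-refl; ↭-prep; ↭-swap; ↭-trans; ↭-sym; ↭⇒↭ₛ; module PermutationReasoning)
open import Data.List.Relation.Binary.Permutation.Propositional.Properties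
  using (↭-length; filter-↭; shift; drop-∷; All-resp-↭)
open import Data.List.Relation.Binary.Pointwise using (Pointwise-≡⇒≡)
open import Data.List.Relation.Unary.All as All using (All; []; _∷_; all?)
open import Data.List.Relation.Unary.AllPairs using (AllPairs; []; _∷_)
import Data.List.Relation.Unary.Any as Any
open import Data.List.Relation.Unary.Any using (here; there)
open import Data.List.Relation.Unary.Linked as Linked using (Linked; [])
open import Data.List.Relation.Unary.Linked.Properties using (AllPairs⇒Linked; Linked⇒AllPairs)
open import Data.List.Relation.Unary.Sorted.TotalOrder.Properties using (↗↭↗⇒≋)
open import Data.List.Relation.Unary.Unique.Propositional using (Unique)
import Data.List.Relation.Unary.Unique.Propositional.Properties as Unique
open import Data.Maybe using (Maybe; just; nothing; maybe)
open import Data.Nat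
  using (ℕ; zero; suc; _+_; _*_; _∸_; _≤_; _<_; _≥_; _≤?_; _≟_; z≤n; s≤s; s≤s⁻¹; z<s;
         NonZero; >-nonZero; >-nonZero⁻¹)
open import Data.List.Relation.Unary.Unique.DecPropositional _≟_ using (unique?)
open import Data.Nat.Divisibility
  using (_∣_; _∣?_; divides; n∣n; _∣0; m∣m*n; n∣m*n; ∣1⇒≡1; ∣m+n∣m⇒∣n; ∣m∣n⇒∣m+n; ∣⇒≤)
open import Data.Nat.ListAction using (sum)
open import Data.Nat.ListAction.Properties using (sum-↭)
open import Data.Nat.Properties
  using (≤-decTotalOrder; ≤-refl; ≤-reflexive; ≤-trans; ≤-antisym; <-trans; <-cmp; <⇒≢; ≰⇒>; 1+n≰n;
         n≤1+n; n<1+n; m<n⇒m<1+n; m<1+n⇒m<n∨m≡n; n≢0⇒n>0; m≤m+n; m≤n+m; m<m+n; m≤n*m;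
         +-comm; +-assoc; +-suc; +-identityʳ; +-cancelˡ-≡; suc-injective; m+[n∸m]≡n; m+n∸m≡n; m∸n≤m;
         *-comm; *-assoc; *-zeroʳ; *-monoʳ-<; m*n≢0; module ≤-Reasoning)
open import Data.Product using (_×_; _,_; proj₁; proj₂)
open import Data.Sum as Sum using (_⊎_; inj₁; inj₂; [_,_]′)
open import Function using (_∘_; id)
open import Level using (Level; 0ℓ)
open import Relation.Binary.Bundles using (DecTotalOrder)
import Relation.Binary.Construct.Flip.EqAndOrd as Flip
open import Relation.Binary.Core using (Rel)
open import Relation.Binary.Definitions using (DecidableEquality; tri<; tri≈; tri>)
open import Relation.Binary.PropositionalEquality
  using (_≡_; _≢_; refl; sym; trans; cong; subst; ≢-sym; module ≡-Reasoning)
open import Relation.Nullary using (¬_; Dec; yes; no; contradiction)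
open import Relation.Nullary.Decidable using (does; ¬?; _×-dec_; _⊎-dec_)
open import Relation.Unary using (Pred; Decidable; _⊆_)

private
  variable
    ℓ p q : Level
    A : Set ℓ
    x y : A
    xs ys : List A

count : {P : Pred A p} → Decidable P → List A → ℕ
count P? xs = length (filter P? xs)

module _ {P : Pred A p} (P? : Decidable P) where

  count-↭ : xs ↭ ys → count P? xs ≡ count P? ys
  count-↭ xs↭ys = ↭-length (filter-↭ P? xs↭ys)

  count-accept : P x → count P? (x ∷ xs) ≡ suc (count P? xs)
  count-accept px = cong length (filter-accept P? px)

  count-reject : ¬ P x → count P? (x ∷ xs) ≡ count P? xs
  count-reject ¬px = cong length (filter-reject P? ¬px)

  count-split : {Q : Pred A q} (Q? : Decidable Q) → Q ⊆ P → ∀ xs →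
                count P? xs ≡ count (λ x → P? x ×-dec ¬? (Q? x)) xs + count Q? xs
  count-split Q? Q⊆P [] = refl
  count-split Q? Q⊆P (x ∷ xs) with P? x | Q? x
  ... | yes _  | yes _  = trans (cong suc (count-split Q? Q⊆P xs)) (sym (+-suc _ _))
  ... | yes _  | no _   = cong suc (count-split Q? Q⊆P xs)
  ... | no ¬px | yes qx = contradiction (Q⊆P qx) ¬px
  ... | no _   | no _   = count-split Q? Q⊆P xs

  count-filter : {Q : Pred A q} (Q? : Decidable Q) → P ⊆ Q → ∀ xs → count P? (filter Q? xs) ≡ count P? xs
  count-filter Q? P⊆Q [] = refl
  count-filter Q? P⊆Q (x ∷ xs) with Q? x
  ... | yes _ with P? x
  ...   | yes _  = cong suc (count-filter Q? P⊆Q xs)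
  ...   | no _   = count-filter Q? P⊆Q xs
  count-filter Q? P⊆Q (x ∷ xs) | no ¬qx with P? x
  ...   | yes px = contradiction (P⊆Q px) ¬qx
  ...   | no _   = count-filter Q? P⊆Q xs

module _ (_≟ᴬ_ : DecidableEquality A) {f : A → A} where

  injective⇒length≤ : Unique xs → (∀ {x} → x ∈ xs → f x ∈ ys) →
                      (∀ {x y} → x ∈ xs → y ∈ xs → f x ≡ f y → x ≡ y) → length xs ≤ length ys
  injective⇒length≤ [] _ _ = z≤n
  injective⇒length≤ {xs = x ∷ xs} {ys} (x∉xs ∷ xs!) maps-to injective = begin-strict
    length xs               ≤⟨ injective⇒length≤ xs! maps-to′ (λ p q → injective (there p) (there q)) ⟩
    length (filter ≢fx? ys) <⟨ filter-notAll ≢fx? ys (Any.map (λ fx≡y fx≢y → fx≢y fx≡y) (maps-to (here refl))) ⟩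
    length ys               ∎
    where
    open ≤-Reasoning
    ≢fx? : Decidable (f x ≢_)
    ≢fx? y = ¬? (f x ≟ᴬ y)
    maps-to′ : ∀ {y} → y ∈ xs → f y ∈ filter ≢fx? ys
    maps-to′ y∈xs = ∈-filter⁺ ≢fx? (maps-to (there y∈xs))
                      (All.lookup x∉xs y∈xs ∘ injective (here refl) (there y∈xs))

  count-involution : {P : Pred A p} {Q : Pred A q} (P? : Decidable P) (Q? : Decidable Q) →
                     Unique xs → (∀ {x} → x ∈ xs → f x ∈ xs) → (∀ {x} → x ∈ xs → f (f x) ≡ x) →
                     (∀ {x} → x ∈ xs → P x → Q (f x)) → (∀ {x} → x ∈ xs → Q x → P (f x)) →
                     count P? xs ≡ count Q? xs
  count-involution {xs = xs} P? Q? xs! closed involutive P⇒Q Q⇒P =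
    ≤-antisym (count-≤ P? Q? P⇒Q) (count-≤ Q? P? Q⇒P)
    where
    injective : ∀ {x y} → x ∈ xs → y ∈ xs → f x ≡ f y → x ≡ y
    injective x∈xs y∈xs fx≡fy = trans (sym (involutive x∈xs)) (trans (cong f fx≡fy) (involutive y∈xs))

    count-≤ : ∀ {p q} {P : Pred A p} {Q : Pred A q} (P? : Decidable P) (Q? : Decidable Q) →
              (∀ {x} → x ∈ xs → P x → Q (f x)) → count P? xs ≤ count Q? xs
    count-≤ P? Q? P⇒Q = injective⇒length≤ (Unique.filter⁺ P? xs!)
      (λ x∈ → let x∈xs , px = ∈-filter⁻ P? x∈ in ∈-filter⁺ Q? (closed x∈xs) (P⇒Q x∈xs px))
      (λ x∈ y∈ → injective (proj₁ (∈-filter⁻ P? x∈)) (proj₁ (∈-filter⁻ P? y∈)))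

Least : Pred ℕ p → ℕ → Set p
Least P a = P a × (∀ {b} → b < a → ¬ P b)

Least-unique : {P : Pred ℕ p} {a b : ℕ} → Least P a → Least P b → a ≡ b
Least-unique {a = a} {b} (pa , a-min) (pb , b-min) with <-cmp a b
... | tri< a<b _ _ = contradiction pa (b-min a<b)
... | tri≈ _ a≡b _ = a≡b
... | tri> _ _ b<a = contradiction pb (a-min b<a)

module _ {P : Pred ℕ p} (P? : Decidable P) where

  least : ℕ → Maybe ℕ
  least zero = nothing
  least (suc n) with least n | P? n
  ... | just a  | _     = just a
  ... | nothing | yes _ = just n
  ... | nothing | no _  = nothing

  least-nothing : ∀ {n} → least n ≡ nothing → ∀ {b} → b < n → ¬ P b
  least-nothing {suc n} eq b<1+n with least n in e | P? n | m<1+n⇒m<n∨m≡n b<1+n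
  least-nothing {suc n} () b<1+n | just _  | _      | _
  least-nothing {suc n} () b<1+n | nothing | yes _  | _
  ... | nothing | no _   | inj₁ b<n  = least-nothing e b<n
  ... | nothing | no ¬pn | inj₂ refl = ¬pn

  least-just⁻ : ∀ {n a} → least n ≡ just a → a < n × Least P a
  least-just⁻ {suc n} eq with least n in e | P? n
  least-just⁻ {suc n} refl | just a  | _      = let a<n , least-a = least-just⁻ {n} e in m<n⇒m<1+n a<n , least-a
  least-just⁻ {suc n} refl | nothing | yes pn = n<1+n n , pn , least-nothing e

  least-just⁺ : ∀ {n a} → a < n → Least P a → least n ≡ just a
  least-just⁺ {n} a<n least-a with least n in e
  ... | just _  = cong just (Least-unique (proj₂ (least-just⁻ {n} e)) least-a)
  ... | nothing = contradiction (proj₁ least-a) (least-nothing {n} e a<n)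

module Multiset {A : Set ℓ} (_≟ᴬ_ : DecidableEquality A) where

  mult : A → List A → ℕ
  mult u = count (_≟ᴬ u)

  mult-here : ∀ u xs → mult u (u ∷ xs) ≡ suc (mult u xs)
  mult-here u xs = count-accept (_≟ᴬ u) refl

  mult-there : x ≢ y → mult y (x ∷ xs) ≡ mult y xs
  mult-there = count-reject (_≟ᴬ _)

  mult≡0 : All (_≢ y) xs → mult y xs ≡ 0
  mult≡0 xs≢y = cong length (filter-none (_≟ᴬ _) xs≢y)

  ∈⇒mult>0 : y ∈ xs → 0 < mult y xs
  ∈⇒mult>0 y∈xs = filter-some (_≟ᴬ _) (Any.map sym y∈xs)

  mult>0⇒∈ : 0 < mult y xs → y ∈ xs
  mult>0⇒∈ {y = y} {xs = x ∷ xs} 0<mult with x ≟ᴬ y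
  ... | yes refl = here refl
  ... | no _     = there (mult>0⇒∈ 0<mult)

  Unique⇒mult≤1 : Unique xs → ∀ u → mult u xs ≤ 1
  Unique⇒mult≤1 [] u = z≤n
  Unique⇒mult≤1 (_∷_ {x} x∉xs xs!) u with x ≟ᴬ u
  ... | yes refl = s≤s (≤-reflexive (mult≡0 (All.map (λ x≢y y≡x → x≢y (sym y≡x)) x∉xs)))
  ... | no _     = Unique⇒mult≤1 xs! u

  mult≤1⇒Unique : (∀ u → mult u xs ≤ 1) → Unique xs
  mult≤1⇒Unique {xs = []} _ = []
  mult≤1⇒Unique {xs = x ∷ xs} mult≤1 = x∉xs ∷ mult≤1⇒Unique (λ u → ≤-trans (mult-≤-∷ u) (mult≤1 u))
    where
    mult-≤-∷ : ∀ u → mult u xs ≤ mult u (x ∷ xs)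
    mult-≤-∷ u with x ≟ᴬ u
    ... | yes _ = n≤1+n _
    ... | no _  = ≤-refl
    x∉xs : All (x ≢_) xs
    x∉xs = All.tabulate λ y∈xs x≡y → 1+n≰n (begin
      2                ≤⟨ s≤s (∈⇒mult>0 (subst (_∈ xs) (sym x≡y) y∈xs)) ⟩
      suc (mult x xs)  ≡⟨ mult-here x xs ⟨
      mult x (x ∷ xs)  ≤⟨ mult≤1 x ⟩
      1                ∎)
      where open ≤-Reasoning

  remove : A → List A → List A
  remove v [] = []
  remove v (x ∷ xs) = if does (x ≟ᴬ v) then xs else x ∷ remove v xs

  remove-↭ : ∀ {v xs} → 0 < mult v xs → xs ↭ v ∷ remove v xs
  remove-↭ {v} {x ∷ xs} 0<mult with x ≟ᴬ v
  ... | yes refl = ↭-refl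
  ... | no _     = ↭-trans (↭-prep x (remove-↭ 0<mult)) (↭-swap x v ↭-refl)

  All-remove : ∀ {P : Pred A p} {v xs} → All P xs → All P (remove v xs)
  All-remove [] = []
  All-remove {v = v} {x ∷ xs} (px ∷ pxs) with x ≟ᴬ v
  ... | yes _ = pxs
  ... | no _  = px ∷ All-remove pxs

  AllPairs-remove : ∀ {R : Rel A p} {v xs} → AllPairs R xs → AllPairs R (remove v xs)
  AllPairs-remove [] = []
  AllPairs-remove {v = v} {x ∷ xs} (x~xs ∷ xs~) with x ≟ᴬ v
  ... | yes _ = xs~
  ... | no _  = All-remove x~xs ∷ AllPairs-remove xs~

open Multiset _≟_

≥-decTotalOrder : DecTotalOrder 0ℓ 0ℓ 0ℓ
≥-decTotalOrder = Flip.decTotalOrder ≤-decTotalOrder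

open DecTotalOrder ≥-decTotalOrder using () renaming (trans to ≥-trans)
open import Data.List.Sort.InsertionSort.Base ≥-decTotalOrder using (insert)
open import Data.List.Sort.InsertionSort.Properties ≥-decTotalOrder using (insert-↭; insert-↗)

↘↭↘⇒≡ : ∀ {xs ys} → Linked _≥_ xs → Linked _≥_ ys → xs ↭ ys → xs ≡ ys
↘↭↘⇒≡ xs↘ ys↘ xs↭ys =
  Pointwise-≡⇒≡ (↗↭↗⇒≋ (DecTotalOrder.totalOrder ≥-decTotalOrder) xs↘ ys↘ (↭⇒↭ₛ xs↭ys))

↘-∷⁺ : ∀ {x xs} → All (_≤ x) xs → Linked _≥_ xs → Linked _≥_ (x ∷ xs)
↘-∷⁺ x≥xs xs↘ = AllPairs⇒Linked (x≥xs ∷ Linked⇒AllPairs ≥-trans xs↘)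

↘-∷⁻ : ∀ {x xs} → Linked _≥_ (x ∷ xs) → All (_≤ x) xs
↘-∷⁻ x∷xs↘ with x≥xs ∷ _ ← Linked⇒AllPairs ≥-trans x∷xs↘ = x≥xs

remove-↘ : ∀ {v xs} → Linked _≥_ xs → Linked _≥_ (remove v xs)
remove-↘ = AllPairs⇒Linked ∘ AllPairs-remove ∘ Linked⇒AllPairs ≥-trans

Merged : ℕ → ℕ → List ℕ → List ℕ → Set
Merged v w xs ys = w ∷ xs ↭ v ∷ v ∷ ys

merge split : ℕ → ℕ → List ℕ → List ℕ
merge v w xs = insert w (remove v (remove v xs))
split v w xs = insert v (insert v (remove w xs))

module _ {v w : ℕ} where

  merge-Merged : ∀ {xs} → 2 ≤ mult v xs → Merged v w xs (merge v w xs)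
  merge-Merged {xs} 2≤mult = begin
    w ∷ xs                              ↭⟨ ↭-prep w xs↭ ⟩
    w ∷ v ∷ v ∷ remove v (remove v xs)  ↭⟨ shift w (v ∷ v ∷ []) _ ⟨
    v ∷ v ∷ w ∷ remove v (remove v xs)  ↭⟨ ↭-prep v (↭-prep v (insert-↭ w _)) ⟨
    v ∷ v ∷ merge v w xs                ∎
    where
    open PermutationReasoning
    0<mult : 0 < mult v xs
    0<mult = ≤-trans (s≤s z≤n) 2≤mult
    0<mult′ : 0 < mult v (remove v xs)
    0<mult′ = s≤s⁻¹ (subst (2 ≤_) (trans (count-↭ (_≟ v) (remove-↭ {v} {xs} 0<mult)) (mult-here v _)) 2≤mult)
    xs↭ : xs ↭ v ∷ v ∷ remove v (remove v xs)
    xs↭ = ↭-trans (remove-↭ {v} {xs} 0<mult) (↭-prep v (remove-↭ {v} {remove v xs} 0<mult′))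

  split-Merged : ∀ {xs} → 0 < mult w xs → Merged v w (split v w xs) xs
  split-Merged {xs} 0<mult = begin
    w ∷ split v w xs         ↭⟨ ↭-prep w (↭-trans (insert-↭ v _) (↭-prep v (insert-↭ v _))) ⟩
    w ∷ v ∷ v ∷ remove w xs  ↭⟨ shift w (v ∷ v ∷ []) _ ⟨
    v ∷ v ∷ w ∷ remove w xs  ↭⟨ ↭-prep v (↭-prep v (remove-↭ {w} {xs} 0<mult)) ⟨
    v ∷ v ∷ xs               ∎
    where open PermutationReasoning

  merge-↘ : ∀ {xs} → Linked _≥_ xs → Linked _≥_ (merge v w xs)
  merge-↘ = insert-↗ w ∘ remove-↘ ∘ remove-↘

  split-↘ : ∀ {xs} → Linked _≥_ xs → Linked _≥_ (split v w xs)
  split-↘ = insert-↗ v ∘ insert-↗ v ∘ remove-↘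

  Merged-injectiveˡ : ∀ {xs xs′ ys} → Linked _≥_ xs → Linked _≥_ xs′ →
                      Merged v w xs ys → Merged v w xs′ ys → xs ≡ xs′
  Merged-injectiveˡ xs↘ xs′↘ xs⇒ys xs′⇒ys = ↘↭↘⇒≡ xs↘ xs′↘ (drop-∷ (↭-trans xs⇒ys (↭-sym xs′⇒ys)))

  Merged-injectiveʳ : ∀ {xs ys ys′} → Linked _≥_ ys → Linked _≥_ ys′ →
                      Merged v w xs ys → Merged v w xs ys′ → ys ≡ ys′
  Merged-injectiveʳ ys↘ ys′↘ xs⇒ys xs⇒ys′ = ↘↭↘⇒≡ ys↘ ys′↘ (drop-∷ (drop-∷ (↭-trans (↭-sym xs⇒ys) xs⇒ys′)))

2∣⇒¬2∣1+ : ∀ {n} → 2 ∣ n → ¬ 2 ∣ suc n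
2∣⇒¬2∣1+ {n} 2∣n 2∣1+n = contradiction (∣1⇒≡1 (∣m+n∣m⇒∣n (subst (2 ∣_) (+-comm 1 n) 2∣1+n) 2∣n)) λ ()

¬2∣⇒2∣1+ : ∀ {n} → ¬ 2 ∣ n → 2 ∣ suc n
¬2∣⇒2∣1+ {zero}        ¬2∣0   = contradiction (2 ∣0) ¬2∣0
¬2∣⇒2∣1+ {suc zero}    _      = n∣n
¬2∣⇒2∣1+ {suc (suc n)} ¬2∣2+n = ∣m∣n⇒∣m+n n∣n (¬2∣⇒2∣1+ (¬2∣2+n ∘ ∣m∣n⇒∣m+n n∣n))

¬2∣1+⇒2∣ : ∀ {n} → ¬ 2 ∣ suc n → 2 ∣ n
¬2∣1+⇒2∣ {n} ¬2∣1+n with 2 ∣? n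
... | yes 2∣n = 2∣n
... | no ¬2∣n = contradiction (¬2∣⇒2∣1+ ¬2∣n) ¬2∣1+n

¬2∣⇒0< : ∀ {n} → ¬ 2 ∣ n → 0 < n
¬2∣⇒0< ¬2∣n = n≢0⇒n>0 λ { refl → ¬2∣n (2 ∣0) }

Adjacent : ℕ → ℕ → Set
Adjacent m n = m ≡ suc n ⊎ n ≡ suc m

Adjacent-sym : ∀ {m n} → Adjacent m n → Adjacent n m
Adjacent-sym = Sum.swap

Adjacent-2∣⇒¬2∣ : ∀ {m n} → Adjacent m n → 2 ∣ m → ¬ 2 ∣ n
Adjacent-2∣⇒¬2∣ (inj₁ refl) 2∣1+n 2∣n = 2∣⇒¬2∣1+ 2∣n 2∣1+n
Adjacent-2∣⇒¬2∣ (inj₂ refl) 2∣m     = 2∣⇒¬2∣1+ 2∣m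

Adjacent-¬2∣⇒2∣ : ∀ {m n} → Adjacent m n → ¬ 2 ∣ m → 2 ∣ n
Adjacent-¬2∣⇒2∣ (inj₁ refl) = ¬2∣1+⇒2∣
Adjacent-¬2∣⇒2∣ (inj₂ refl) = ¬2∣⇒2∣1+

module _ {v w : ℕ} {xs ys : List ℕ} (xs⇒ys : Merged v w xs ys) where

  Merged-sum : w ≡ v + v → sum xs ≡ sum ys
  Merged-sum refl = +-cancelˡ-≡ (v + v) _ _ (begin
    v + v + sum xs    ≡⟨ sum-↭ xs⇒ys ⟩
    v + (v + sum ys)  ≡⟨ +-assoc v v _ ⟨
    v + v + sum ys    ∎)
    where open ≡-Reasoning

  Merged-All⁺ : ∀ {P : Pred ℕ p} → P w → All P xs → All P ys
  Merged-All⁺ pw pxs with _ ∷ _ ∷ pys ← All-resp-↭ xs⇒ys (pw ∷ pxs) = pys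

  Merged-All⁻ : ∀ {P : Pred ℕ p} → P v → All P ys → All P xs
  Merged-All⁻ pv pys with _ ∷ pxs ← All-resp-↭ (↭-sym xs⇒ys) (pv ∷ pv ∷ pys) = pxs

  Merged-mult : ∀ {u} → u ≢ v → u ≢ w → mult u xs ≡ mult u ys
  Merged-mult {u} u≢v u≢w = begin
    mult u xs            ≡⟨ mult-there (≢-sym u≢w) ⟨
    mult u (w ∷ xs)      ≡⟨ count-↭ (_≟ u) xs⇒ys ⟩
    mult u (v ∷ v ∷ ys)  ≡⟨ trans (mult-there (≢-sym u≢v)) (mult-there (≢-sym u≢v)) ⟩
    mult u ys            ∎
    where open ≡-Reasoning

  Merged-mult-v : v ≢ w → mult v xs ≡ 2 + mult v ys
  Merged-mult-v v≢w = begin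
    mult v xs            ≡⟨ mult-there (≢-sym v≢w) ⟨
    mult v (w ∷ xs)      ≡⟨ count-↭ (_≟ v) xs⇒ys ⟩
    mult v (v ∷ v ∷ ys)  ≡⟨ trans (mult-here v _) (cong suc (mult-here v ys)) ⟩
    2 + mult v ys        ∎
    where open ≡-Reasoning

  Merged-mult-w : v ≢ w → mult w ys ≡ 1 + mult w xs
  Merged-mult-w v≢w = begin
    mult w ys            ≡⟨ trans (mult-there v≢w) (mult-there v≢w) ⟨
    mult w (v ∷ v ∷ ys)  ≡⟨ count-↭ (_≟ w) xs⇒ys ⟨
    mult w (w ∷ xs)      ≡⟨ mult-here w xs ⟩
    1 + mult w xs        ∎
    where open ≡-Reasoning

  Merged-count : ∀ {P : Pred ℕ p} (P? : Decidable P) → P w → Adjacent (count P? xs) (count P? ys)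
  Merged-count P? pw with P? v
  ... | yes pv = inj₁ (suc-injective (begin
    suc (count P? xs)        ≡⟨ count-accept P? pw ⟨
    count P? (w ∷ xs)        ≡⟨ count-↭ P? xs⇒ys ⟩
    count P? (v ∷ v ∷ ys)    ≡⟨ trans (count-accept P? pv) (cong suc (count-accept P? pv)) ⟩
    suc (suc (count P? ys))  ∎))
    where open ≡-Reasoning
  ... | no ¬pv = inj₂ (begin
    count P? ys              ≡⟨ trans (count-reject P? ¬pv) (count-reject P? ¬pv) ⟨
    count P? (v ∷ v ∷ ys)    ≡⟨ count-↭ P? xs⇒ys ⟨
    count P? (w ∷ xs)        ≡⟨ count-accept P? pw ⟩
    suc (count P? xs)        ∎)
    where open ≡-Reasoning

Toggled : ℕ → ℕ → List ℕ → List ℕ → Set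
Toggled v w xs ys = Merged v w xs ys ⊎ Merged v w ys xs

module _ {v w : ℕ} {xs ys : List ℕ} where

  Toggled-sum : w ≡ v + v → Toggled v w xs ys → sum xs ≡ sum ys
  Toggled-sum w≡2v = [ (λ xs⇒ys → Merged-sum xs⇒ys w≡2v) , (λ ys⇒xs → sym (Merged-sum ys⇒xs w≡2v)) ]′

  Toggled-All : ∀ {P : Pred ℕ p} → P v → P w → Toggled v w xs ys → All P xs → All P ys
  Toggled-All pv pw = [ (λ xs⇒ys → Merged-All⁺ xs⇒ys pw) , (λ ys⇒xs → Merged-All⁻ ys⇒xs pv) ]′

  Toggled-mult : ∀ {u} → u ≢ v → u ≢ w → Toggled v w xs ys → mult u xs ≡ mult u ys
  Toggled-mult u≢v u≢w =
    [ (λ xs⇒ys → Merged-mult xs⇒ys u≢v u≢w) , (λ ys⇒xs → sym (Merged-mult ys⇒xs u≢v u≢w)) ]′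

  Toggled-mult-2∣ : ∀ {u} → v ≢ w → u ≢ w → Toggled v w xs ys → 2 ∣ mult u xs → 2 ∣ mult u ys
  Toggled-mult-2∣ {u} v≢w u≢w xs~ys 2∣mult with u ≟ v | xs~ys
  ... | yes refl | inj₁ xs⇒ys = ∣m+n∣m⇒∣n (subst (2 ∣_) (Merged-mult-v xs⇒ys v≢w) 2∣mult) n∣n
  ... | yes refl | inj₂ ys⇒xs = subst (2 ∣_) (sym (Merged-mult-v ys⇒xs v≢w)) (∣m∣n⇒∣m+n n∣n 2∣mult)
  ... | no u≢v   | _          = subst (2 ∣_) (Toggled-mult u≢v u≢w xs~ys) 2∣mult

  Toggled-count : ∀ {P : Pred ℕ p} (P? : Decidable P) → P w → Toggled v w xs ys →
                  Adjacent (count P? xs) (count P? ys)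
  Toggled-count P? pw =
    [ (λ xs⇒ys → Merged-count xs⇒ys P? pw) , (λ ys⇒xs → Adjacent-sym (Merged-count ys⇒xs P? pw)) ]′

Toggleable : ℕ → ℕ → List ℕ → Set
Toggleable v w xs = ¬ 2 ∣ mult w xs ⊎ 2 ≤ mult v xs

toggleable? : ∀ v w → Decidable (Toggleable v w)
toggleable? v w xs = ¬? (2 ∣? mult w xs) ⊎-dec (2 ≤? mult v xs)

toggle : ℕ → ℕ → List ℕ → List ℕ
toggle v w xs = if does (2 ∣? mult w xs) then merge v w xs else split v w xs

module _ {v w : ℕ} where

  toggle-cases : ∀ {xs} (P : List ℕ → Set p) → (2 ∣ mult w xs → P (merge v w xs)) →
                 (¬ 2 ∣ mult w xs → P (split v w xs)) → P (toggle v w xs)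
  toggle-cases {xs = xs} P if-even if-odd = by-parity (2 ∣? mult w xs)
    where
    by-parity : (even? : Dec (2 ∣ mult w xs)) → P (if does even? then merge v w xs else split v w xs)
    by-parity (yes 2∣mult) = if-even 2∣mult
    by-parity (no ¬2∣mult) = if-odd ¬2∣mult

  Toggleable-2≤mult : ∀ {xs} → Toggleable v w xs → 2 ∣ mult w xs → 2 ≤ mult v xs
  Toggleable-2≤mult toggleable 2∣mult = [ contradiction 2∣mult , id ]′ toggleable

  toggle-↘ : ∀ {xs} → Linked _≥_ xs → Linked _≥_ (toggle v w xs)
  toggle-↘ {xs} xs↘ = toggle-cases {xs = xs} (Linked _≥_) (λ _ → merge-↘ xs↘) (λ _ → split-↘ xs↘)

  toggle-Toggled : ∀ {xs} → Toggleable v w xs → Toggled v w xs (toggle v w xs)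
  toggle-Toggled {xs} toggleable = toggle-cases {xs = xs} (Toggled v w xs)
    (λ 2∣mult → inj₁ (merge-Merged (Toggleable-2≤mult {xs} toggleable 2∣mult)))
    (λ ¬2∣mult → inj₂ (split-Merged (¬2∣⇒0< ¬2∣mult)))

  module _ (v≢w : v ≢ w) {xs : List ℕ} where

    merge-mult-w : 2 ≤ mult v xs → mult w (merge v w xs) ≡ 1 + mult w xs
    merge-mult-w 2≤mult = Merged-mult-w (merge-Merged {v} {w} {xs} 2≤mult) v≢w

    split-mult-v : 0 < mult w xs → mult v (split v w xs) ≡ 2 + mult v xs
    split-mult-v 0<mult = Merged-mult-v (split-Merged {v} {w} {xs} 0<mult) v≢w

    split-mult-w : 0 < mult w xs → mult w xs ≡ 1 + mult w (split v w xs)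
    split-mult-w 0<mult = Merged-mult-w (split-Merged {v} {w} {xs} 0<mult) v≢w

    toggle-Toggleable : Toggleable v w xs → Toggleable v w (toggle v w xs)
    toggle-Toggleable toggleable = toggle-cases {xs = xs} (Toggleable v w)
      (λ 2∣mult → inj₁ (subst (¬_ ∘ (2 ∣_)) (sym (merge-mult-w (Toggleable-2≤mult {xs} toggleable 2∣mult)))
                                           (2∣⇒¬2∣1+ 2∣mult)))
      (λ ¬2∣mult → inj₂ (subst (2 ≤_) (sym (split-mult-v (¬2∣⇒0< ¬2∣mult))) (m≤m+n 2 _)))

    toggle-involutive : Linked _≥_ xs → Toggleable v w xs → toggle v w (toggle v w xs) ≡ xs
    toggle-involutive xs↘ toggleable = toggle-cases {xs = xs} (λ ys → toggle v w ys ≡ xs) after-merge after-split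
      where
      after-merge : 2 ∣ mult w xs → toggle v w (merge v w xs) ≡ xs
      after-merge 2∣mult = toggle-cases {xs = merge v w xs} (_≡ xs)
        (λ 2∣mult′ → contradiction (subst (2 ∣_) (merge-mult-w 2≤mult) 2∣mult′) (2∣⇒¬2∣1+ 2∣mult))
        (λ ¬2∣mult′ → Merged-injectiveˡ (split-↘ (merge-↘ xs↘)) xs↘
                        (split-Merged {v} {w} {merge v w xs} (¬2∣⇒0< ¬2∣mult′)) (merge-Merged 2≤mult))
        where 2≤mult = Toggleable-2≤mult {xs} toggleable 2∣mult
      after-split : ¬ 2 ∣ mult w xs → toggle v w (split v w xs) ≡ xs
      after-split ¬2∣mult = toggle-cases {xs = split v w xs} (_≡ xs)
        (λ 2∣mult′ → Merged-injectiveʳ (merge-↘ (split-↘ xs↘)) xs↘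
                        (merge-Merged {v} {w} {split v w xs} (subst (2 ≤_) (sym (split-mult-v 0<mult)) (m≤m+n 2 _)))
                        (split-Merged 0<mult))
        (λ ¬2∣mult′ → contradiction (subst (2 ∣_) (sym (split-mult-w 0<mult)) (¬2∣⇒2∣1+ ¬2∣mult′)) ¬2∣mult)
        where 0<mult = ¬2∣⇒0< ¬2∣mult

∈⇒≤sum : ∀ {n ns} → n ∈ ns → n ≤ sum ns
∈⇒≤sum {ns = n ∷ ns} (here refl)  = m≤m+n n (sum ns)
∈⇒≤sum {ns = m ∷ ns} (there n∈ns) = ≤-trans (∈⇒≤sum n∈ns) (m≤n+m (sum ns) m)

concatMap-unique : ∀ {A B : Set} {f : A → List B} {xs} → Unique xs → (∀ x → Unique (f x)) →
                   (∀ {x y z} → z ∈ f x → z ∈ f y → x ≡ y) → Unique (concatMap f xs)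
concatMap-unique [] _ _ = []
concatMap-unique {f = f} {x ∷ xs} (x∉xs ∷ xs!) f! f-disjoint =
  Unique.++⁺ (f! x) (concatMap-unique xs! f! f-disjoint) λ (z∈fx , z∈fxs) →
    let y , y∈xs , z∈fy = find (∈-concatMap⁻ f z∈fxs) in
    All.lookup x∉xs y∈xs (f-disjoint z∈fx z∈fy)

∈-partsBounded⁻ : ∀ f n m {xs} → xs ∈ partsBounded f n m → IsPartition n xs × All (_≤ m) xs
∈-partsBounded⁻ f       zero    m (here refl) = ([] , [] , refl) , []
∈-partsBounded⁻ (suc f) (suc n) m xs∈
  with k , k∈ks , xs∈blockₖ ← find (∈-concatMap⁻ _ {xs = filter (λ k → suc k ≤? m) (upTo (suc n))} xs∈)
  with k∈upTo , 1+k≤m ← ∈-filter⁻ (λ k → suc k ≤? m) {xs = upTo (suc n)} k∈ks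
     | rest , rest∈ , refl ← ∈-map⁻ (suc k ∷_) xs∈blockₖ
  with (rest>0 , rest↘ , sum-rest) , rest≤1+k ← ∈-partsBounded⁻ f (n ∸ k) (suc k) rest∈
  = (s≤s z≤n ∷ rest>0 , ↘-∷⁺ rest≤1+k rest↘ , sum≡) , 1+k≤m ∷ All.map (λ p≤1+k → ≤-trans p≤1+k 1+k≤m) rest≤1+k
  where
  sum≡ : suc k + sum rest ≡ suc n
  sum≡ = cong suc (trans (cong (k +_) sum-rest) (m+[n∸m]≡n (s≤s⁻¹ (∈-upTo⁻ k∈upTo))))

∈-partsBounded⁺ : ∀ {f n m xs} → n ≤ f → IsPartition n xs → All (_≤ m) xs → xs ∈ partsBounded f n m
∈-partsBounded⁺ {n = zero} {xs = []}    _ _ _ = here refl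
∈-partsBounded⁺ {n = zero} {xs = _ ∷ _} _ (s≤s _ ∷ _ , _ , ()) _
∈-partsBounded⁺ {suc f} {suc n} {m} {suc k ∷ rest} (s≤s n≤f) (_ ∷ rest>0 , k∷rest↘ , sum≡) (1+k≤m ∷ _) =
  ∈-concatMap⁺ _ (lose (∈-filter⁺ (λ k → suc k ≤? m) (∈-upTo⁺ k<1+n) 1+k≤m)
                       (∈-map⁺ (suc k ∷_) (∈-partsBounded⁺ (≤-trans (m∸n≤m n k) n≤f)
                                                          (rest>0 , Linked.tail k∷rest↘ , sum-rest)
                                                          (↘-∷⁻ k∷rest↘))))
  where
  k<1+n : k < suc n
  k<1+n = subst (suc k ≤_) sum≡ (m≤m+n (suc k) (sum rest))
  sum-rest : sum rest ≡ n ∸ k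
  sum-rest = trans (sym (m+n∸m≡n k (sum rest))) (cong (_∸ k) (suc-injective sum≡))

partsBounded-unique : ∀ f n m → Unique (partsBounded f n m)
partsBounded-unique f       zero    m = [] ∷ []
partsBounded-unique zero    (suc n) m = []
partsBounded-unique (suc f) (suc n) m =
  concatMap-unique (Unique.filter⁺ (λ k → suc k ≤? m) (Unique.upTo⁺ (suc n)))
    (λ k → Unique.map⁺ ∷-injectiveʳ (partsBounded-unique f (n ∸ k) (suc k)))
    λ z∈blockₖ z∈blockₗ →
      let _ , _ , z≡k∷ = ∈-map⁻ _ z∈blockₖ ; _ , _ , z≡l∷ = ∈-map⁻ _ z∈blockₗ in
      suc-injective (∷-injectiveˡ (trans (sym z≡k∷) z≡l∷))

∈-partitions⁻ : ∀ {n xs} → xs ∈ partitions n → IsPartition n xs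
∈-partitions⁻ {n} xs∈ = proj₁ (∈-partsBounded⁻ n n n xs∈)

∈-partitions⁺ : ∀ {n xs} → IsPartition n xs → xs ∈ partitions n
∈-partitions⁺ xs-part@(_ , _ , refl) = ∈-partsBounded⁺ ≤-refl xs-part (All.tabulate ∈⇒≤sum)

partitions-unique : ∀ n → Unique (partitions n)
partitions-unique n = partsBounded-unique n n n

multiple-part-bound : ∀ d .{{_ : NonZero d}} {n xs a} → IsPartition n xs → d * a ∈ xs → 0 < a × a ≤ n
multiple-part-bound d {a = zero}  (xs>0 , _ , _) d0∈xs =
  contradiction (subst (1 ≤_) (*-zeroʳ d) (All.lookup xs>0 d0∈xs)) λ ()
multiple-part-bound d {a = suc a} (_ , _ , refl) da∈xs = z<s , ≤-trans (m≤n*m (suc a) d) (∈⇒≤sum da∈xs)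

module _ (r : ℕ) .{{_ : NonZero r}} where

  ToggleableAt : ℕ → List ℕ → Set
  ToggleableAt a = Toggleable (r * a) (2 * r * a)

  toggleableAt? : ∀ a → Decidable (ToggleableAt a)
  toggleableAt? a = toggleable? (r * a) (2 * r * a)

  toggleAt : ℕ → List ℕ → List ℕ
  toggleAt a = toggle (r * a) (2 * r * a)

  2ra≡ra+ra : ∀ a → 2 * r * a ≡ r * a + r * a
  2ra≡ra+ra a = trans (*-assoc 2 r a) (cong (r * a +_) (+-identityʳ (r * a)))

  2ra≡r[2a] : ∀ a → 2 * r * a ≡ r * (2 * a)
  2ra≡r[2a] a = trans (cong (_* a) (*-comm 2 r)) (*-assoc r 2 a)

  0<ra : ∀ a .{{_ : NonZero a}} → 0 < r * a
  0<ra a = >-nonZero⁻¹ (r * a) {{m*n≢0 r a}}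

  ra<2ra : ∀ a .{{_ : NonZero a}} → r * a < 2 * r * a
  ra<2ra a = subst (r * a <_) (sym (2ra≡ra+ra a)) (m<m+n (r * a) (0<ra a))

  module _ {a : ℕ} .{{_ : NonZero a}} {xs : List ℕ} (toggleable : ToggleableAt a xs) where

    private
      ra≢2ra : r * a ≢ 2 * r * a
      ra≢2ra = <⇒≢ (ra<2ra a)

      toggled : Toggled (r * a) (2 * r * a) xs (toggleAt a xs)
      toggled = toggle-Toggled {r * a} {2 * r * a} {xs} toggleable

    toggleAt-IsPartition : ∀ {n} → IsPartition n xs → IsPartition n (toggleAt a xs)
    toggleAt-IsPartition (xs>0 , xs↘ , refl) =
      Toggled-All (0<ra a) (<-trans (0<ra a) (ra<2ra a)) toggled xs>0 ,
      toggle-↘ xs↘ ,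
      sym (Toggled-sum (2ra≡ra+ra a) toggled)

    toggleAt-ToggleableAt : ToggleableAt a (toggleAt a xs)
    toggleAt-ToggleableAt = toggle-Toggleable ra≢2ra {xs} toggleable

    toggleAt-involutive : Linked _≥_ xs → toggleAt a (toggleAt a xs) ≡ xs
    toggleAt-involutive xs↘ = toggle-involutive ra≢2ra {xs} xs↘ toggleable

    toggleAt-countDiv : Adjacent (countDiv (2 * r) xs) (countDiv (2 * r) (toggleAt a xs))
    toggleAt-countDiv = Toggled-count (2 * r ∣?_) (m∣m*n a) toggled

    ToggleableAt-toggleAt⁻ : ∀ {c} → c < a → ToggleableAt c (toggleAt a xs) → ToggleableAt c xs
    ToggleableAt-toggleAt⁻ {c} c<a = Sum.map
      (λ odd even → odd (Toggled-mult-2∣ ra≢2ra 2rc≢2ra toggled even))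
      (subst (2 ≤_) (sym (Toggled-mult rc≢ra rc≢2ra toggled)))
      where
      rc<ra : r * c < r * a
      rc<ra = *-monoʳ-< r c<a
      rc≢ra : r * c ≢ r * a
      rc≢ra = <⇒≢ rc<ra
      rc≢2ra : r * c ≢ 2 * r * a
      rc≢2ra = <⇒≢ (<-trans rc<ra (ra<2ra a))
      2rc≢2ra : 2 * r * c ≢ 2 * r * a
      2rc≢2ra = <⇒≢ (*-monoʳ-< (2 * r) {{m*n≢0 2 r}} c<a)

  Exceptional : List ℕ → Set
  Exceptional xs = All (λ x → ¬ 2 * r ∣ x) xs × Unique (filter (r ∣?_) xs)

  exceptional? : Decidable Exceptional
  exceptional? xs = all? (λ x → ¬? (2 * r ∣? x)) xs ×-dec unique? (filter (r ∣?_) xs)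

  Exceptional⇒2∣countDiv : ∀ {xs} → Exceptional xs → 2 ∣ countDiv (2 * r) xs
  Exceptional⇒2∣countDiv (¬2r∣xs , _) =
    subst (2 ∣_) (sym (cong length (filter-none (2 * r ∣?_) ¬2r∣xs))) (2 ∣0)

  Exceptional⇒¬ToggleableAt : ∀ {xs} a → Exceptional xs → ¬ ToggleableAt a xs
  Exceptional⇒¬ToggleableAt {xs} a (¬2r∣xs , r∣xs!) =
    [ (λ odd → odd (subst (2 ∣_) (sym mult-2ra≡0) (2 ∣0))) , (λ 2≤mult → 1+n≰n (≤-trans 2≤mult mult-ra≤1)) ]′
    where
    mult-2ra≡0 : mult (2 * r * a) xs ≡ 0
    mult-2ra≡0 = mult≡0 (All.map (λ ¬2r∣x x≡2ra → ¬2r∣x (subst (2 * r ∣_) (sym x≡2ra) (m∣m*n a))) ¬2r∣xs)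
    mult-ra≤1 : mult (r * a) xs ≤ 1
    mult-ra≤1 = subst (_≤ 1) (count-filter (_≟ r * a) (r ∣?_) (λ { refl → m∣m*n a }) xs)
                      (Unique⇒mult≤1 r∣xs! (r * a))

  untoggleable⇒Exceptional : ∀ {n xs} → IsPartition n xs → (∀ {a} → 0 < a → a ≤ n → ¬ ToggleableAt a xs) →
                             Exceptional xs
  untoggleable⇒Exceptional {n} {xs} xs-part untoggleable = All.tabulate ¬2r∣ , mult≤1⇒Unique mult≤1
    where
    untoggleable-at-part : ∀ d .{{_ : NonZero d}} {a} → d * a ∈ xs → ¬ ToggleableAt a xs
    untoggleable-at-part d da∈xs = let 0<a , a≤n = multiple-part-bound d xs-part da∈xs in untoggleable 0<a a≤n

    ¬2r∣ : ∀ {x} → x ∈ xs → ¬ 2 * r ∣ x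
    ¬2r∣ x∈xs (divides q refl) = by-parity (2 ∣? mult (2 * r * q) xs)
      where
      2rq∈xs : 2 * r * q ∈ xs
      2rq∈xs = subst (_∈ xs) (*-comm q (2 * r)) x∈xs
      by-parity : Dec (2 ∣ mult (2 * r * q) xs) → ⊥
      by-parity (no odd)   = untoggleable-at-part (2 * r) {{m*n≢0 2 r}} 2rq∈xs (inj₁ odd)
      by-parity (yes even) = untoggleable-at-part r (subst (_∈ xs) (2ra≡r[2a] q) 2rq∈xs)
        (inj₂ (subst (λ u → 2 ≤ mult u xs) (2ra≡r[2a] q) (∣⇒≤ {{>-nonZero (∈⇒mult>0 2rq∈xs)}} even)))

    mult≤1 : ∀ u → mult u (filter (r ∣?_) xs) ≤ 1
    mult≤1 u with 2 ≤? mult u (filter (r ∣?_) xs)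
    ... | no ≱2 = s≤s⁻¹ (≰⇒> ≱2)
    ... | yes 2≤mult with u∈xs , divides q refl ← ∈-filter⁻ (r ∣?_) {xs = xs} (mult>0⇒∈ (≤-trans (s≤s z≤n) 2≤mult)) =
      ⊥-elim (untoggleable-at-part r (subst (_∈ xs) (*-comm q r) u∈xs)
        (inj₂ (subst (λ u → 2 ≤ mult u xs) (*-comm q r)
                     (subst (2 ≤_) (count-filter (_≟ q * r) (r ∣?_) (λ { refl → n∣m*n q }) xs) 2≤mult))))

  -- `just b` stands for the least a = suc b ≤ n at which the partition is toggleable.
  firstToggleable : ℕ → List ℕ → Maybe ℕ
  firstToggleable n xs = least (λ b → toggleableAt? (suc b) xs) n

  involution : ℕ → List ℕ → List ℕ
  involution n xs = maybe (λ b → toggleAt (suc b) xs) xs (firstToggleable n xs)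

  firstToggleable-nothing : ∀ {n xs} → IsPartition n xs → firstToggleable n xs ≡ nothing → Exceptional xs
  firstToggleable-nothing {xs = xs} xs-part eq = untoggleable⇒Exceptional xs-part
    λ { {suc b} _ b<n → least-nothing (λ b → toggleableAt? (suc b) xs) eq b<n }

  firstToggleable-just : ∀ {n xs b} → firstToggleable n xs ≡ just b →
                         b < n × Least (λ b → ToggleableAt (suc b) xs) b
  firstToggleable-just {xs = xs} = least-just⁻ (λ b → toggleableAt? (suc b) xs)

  firstToggleable-toggleAt : ∀ {n xs b} → firstToggleable n xs ≡ just b →
                             firstToggleable n (toggleAt (suc b) xs) ≡ just b
  firstToggleable-toggleAt {n} {xs} eq with b<n , toggleable , minimal ← firstToggleable-just {n} {xs} eq =
    least-just⁺ _ b<n (toggleAt-ToggleableAt {xs = xs} toggleable ,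
                       λ c<b → minimal c<b ∘ ToggleableAt-toggleAt⁻ {xs = xs} toggleable (s≤s c<b))

  involution-nothing : ∀ {n xs} → firstToggleable n xs ≡ nothing → involution n xs ≡ xs
  involution-nothing {xs = xs} = cong (maybe (λ b → toggleAt (suc b) xs) xs)

  involution-just : ∀ {n xs b} → firstToggleable n xs ≡ just b → involution n xs ≡ toggleAt (suc b) xs
  involution-just {xs = xs} = cong (maybe (λ b → toggleAt (suc b) xs) xs)

  involution-cases : ∀ {n xs} (P : List ℕ → Set p) → (firstToggleable n xs ≡ nothing → P xs) →
                     (∀ {b} → firstToggleable n xs ≡ just b → P (toggleAt (suc b) xs)) → P (involution n xs)
  involution-cases {n = n} {xs} P if-nothing if-just = by-search (firstToggleable n xs) refl
    where
    by-search : ∀ m → firstToggleable n xs ≡ m → P (maybe (λ b → toggleAt (suc b) xs) xs m)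
    by-search nothing  eq = if-nothing eq
    by-search (just b) eq = if-just eq

  module _ {n : ℕ} {xs : List ℕ} (xs-part : IsPartition n xs) where

    private
      toggleable : ∀ {b} → firstToggleable n xs ≡ just b → ToggleableAt (suc b) xs
      toggleable eq = proj₁ (proj₂ (firstToggleable-just {n} {xs} eq))

    involution-IsPartition : IsPartition n (involution n xs)
    involution-IsPartition = involution-cases {n = n} {xs = xs} (IsPartition n) (λ _ → xs-part)
      λ eq → toggleAt-IsPartition (toggleable eq) xs-part

    involution-involutive : involution n (involution n xs) ≡ xs
    involution-involutive = involution-cases {n = n} {xs = xs} (λ ys → involution n ys ≡ xs) (involution-nothing {n})
      λ {b} eq → trans (involution-just {n} {toggleAt (suc b) xs} (firstToggleable-toggleAt {n} {xs} eq))
                       (toggleAt-involutive {xs = xs} (toggleable eq) (proj₁ (proj₂ xs-part)))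

    module _ (¬exceptional : ¬ Exceptional xs) where

      private
        impossible : ∀ {A : Set} → firstToggleable n xs ≡ nothing → A
        impossible eq = contradiction (firstToggleable-nothing xs-part eq) ¬exceptional

      involution-countDiv : Adjacent (countDiv (2 * r) xs) (countDiv (2 * r) (involution n xs))
      involution-countDiv = involution-cases {n = n} {xs = xs}
        (λ ys → Adjacent (countDiv (2 * r) xs) (countDiv (2 * r) ys))
        impossible (toggleAt-countDiv {xs = xs} ∘ toggleable)

      involution-¬Exceptional : ¬ Exceptional (involution n xs)
      involution-¬Exceptional = involution-cases {n = n} {xs = xs} (¬_ ∘ Exceptional) impossible
        λ {b} eq exceptional →
          Exceptional⇒¬ToggleableAt (suc b) exceptional (toggleAt-ToggleableAt {xs = xs} (toggleable eq))

  even? : Decidable (λ xs → 2 ∣ countDiv (2 * r) xs)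
  even? xs = 2 ∣? countDiv (2 * r) xs

  count-even-¬Exceptional≡po : ∀ n →
    count (λ xs → even? xs ×-dec ¬? (exceptional? xs)) (partitions n) ≡ po n (2 * r)
  count-even-¬Exceptional≡po n = count-involution (≡-dec _≟_) _ (¬? ∘ even?) (partitions-unique n)
    (∈-partitions⁺ ∘ involution-IsPartition ∘ part) (involution-involutive ∘ part)
    (λ xs∈ (even , ¬exceptional) → Adjacent-2∣⇒¬2∣ (involution-countDiv (part xs∈) ¬exceptional) even)
    (λ xs∈ odd → let ¬exceptional = odd ∘ Exceptional⇒2∣countDiv in
      Adjacent-¬2∣⇒2∣ (involution-countDiv (part xs∈) ¬exceptional) odd ,
      involution-¬Exceptional (part xs∈) ¬exceptional)
    where
    part : ∀ {xs} → xs ∈ partitions n → IsPartition n xs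
    part = ∈-partitions⁻

theorem1p4 : (r : ℕ) → .{{_ : NonZero r}} → (n : ℕ) →
    pe n (2 * r) ≡ po n (2 * r) + qo n r
theorem1p4 r n = begin
  pe n (2 * r)
    ≡⟨ count-split (even? r) (exceptional? r) (Exceptional⇒2∣countDiv r) (partitions n) ⟩
  count (λ xs → even? r xs ×-dec ¬? (exceptional? r xs)) (partitions n) + qo n r
    ≡⟨ cong (_+ qo n r) (count-even-¬Exceptional≡po r n) ⟩
  po n (2 * r) + qo n r
    ∎
  where open ≡-Reasoning
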